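{- Let $R=([n],\triangleright)$ be a rack. Let $C$ be the vertex set of a component of $G_{T(R)}$ and let $v\in C$. Then for any $j\in[n]$, knowledge of the maps $(f_l|_{T(R)})_{l\in[n]}$ and $(f_i)_{i\in T^+(R)}$ together with the vertex $(v)f_j$ is sufficient to determine the map $f_j|_C$.
   Context: Maps are written on the right; $(x)f_y=x\triangleright y$, each $f_y$ a permutation of $[n]$ with $f_{(y)f_z}=f_z^{ -1}f_yf_z$. For $S\subseteq[n]$, $G_S$ is the directed loopless multigraph on $[n]$ with an edge of colour $y$ from $x$ to $z$ iff $y\in S$, $x\neq z$, $(x)f_y=z$; components are those of the underlying undirected multigraph, $\mathrm{cp}(G)$ their number. $\Gamma_T^+(v)=\{(v)f_j: j\in T,\ (v)f_j\neq v\}$, $\Gamma_T^+(V)=\bigcup_{v\in V}\Gamma_T^+(v)$, $d_T^+=|\Gamma_T^+|$, with subscript $R$ meaning $T=[n]$. $\Delta=(\log_2 n)^3$, $L=\lfloor(\log_2 n)^2\rfloor$, $S_{\leqslant\Delta}(R)=\{v: d_R^+(v)\leqslant\Delta\}$. $T(R)$: if $S_{\leqslant\Delta}(R)=\emptyset$, $T(R)=\emptyset$; otherwise order $S_{\leqslant\Delta}(R)$ as $u_1,u_2,\dots$ where each $u_{k+1}$ minimises $\mathrm{cp}(G_{\{u_1,\dots,u_k,v\}})$ over remaining $v\in S_{\leqslant\Delta}(R)$, and $T(R)=\{u_1,\dots,u_L\}$ if $|S_{\leqslant\Delta}(R)|\geqslant L$, else $T(R)=S_{\leqslant\Delta}(R)$.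 $T^+(R)=T(R)\cup\Gamma_R^+(T(R))$ (which is determined by the maps $(f_l|_{T(R)})_{l\in[n]}$). -}

module Defs where

open import Data.Nat using (ℕ; zero; suc; _+_; _*_; _^_; _≤_; _<_)
open import Data.Fin using (Fin)
open import Data.Fin.Permutation using (Permutation′; _⟨$⟩ʳ_; _⟨$⟩ˡ_)
open import Data.List using (List; []; _∷_; length)
open import Data.List.Membership.Propositional using (_∈_; _∉_)
open import Data.Product using (Σ; _×_; ∃; ∃-syntax)
open import Data.Sum using (_⊎_)
open import Relation.Binary.PropositionalEquality using (_≡_; _≢_)
open import Relation.Binary.Construct.Closure.ReflexiveTransitive using (Star)
open import Relation.Nullary using (¬_)
open import Function.Definitions using (Surjective)

-- A rack on [n] = Fin n.  f y is the permutation f_y; maps act on the right,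
-- (x) f_y = f y ⟨$⟩ʳ x = x ▷ y.  Rack axiom: f_{(y)f_z} = f_z⁻¹ f_y f_z
-- (composition left to right), i.e. (x) f_{(y)f_z} = (((x) f_z⁻¹) f_y) f_z.
record Rack (n : ℕ) : Set where
  field
    f    : Fin n → Permutation′ n
    rack : ∀ y z x → f (f z ⟨$⟩ʳ y) ⟨$⟩ʳ x ≡ f z ⟨$⟩ʳ (f y ⟨$⟩ʳ (f z ⟨$⟩ˡ x))

  _▷_ : Fin n → Fin n → Fin n
  x ▷ y = f y ⟨$⟩ʳ x

open Rack public

module _ {n : ℕ} (R : Rack n) where
  _▷ᴿ_ : Fin n → Fin n → Fin n
  x ▷ᴿ y = _▷_ R x y

  -- Undirected adjacency in G_S (S a set of colours given as a predicate):
  -- an edge of colour y ∈ S between x and z, x ≠ z, in either direction.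
  Adj : (Fin n → Set) → Fin n → Fin n → Set
  Adj S x z = Σ (Fin n) λ y → S y × x ≢ z × (x ▷ᴿ y ≡ z ⊎ z ▷ᴿ y ≡ x)

  Conn : (Fin n → Set) → Fin n → Fin n → Set
  Conn S = Star (Adj S)

  -- cp(G_S) = k : the components are in bijection with Fin k, i.e. there is
  -- a surjection Fin n → Fin k whose fibres are exactly the components.
  NumComp : (Fin n → Set) → ℕ → Set
  NumComp S k = Σ (Fin n → Fin k) λ rep →
    Surjective _≡_ _≡_ rep × (∀ x y → (rep x ≡ rep y → Conn S x y) × (Conn S x y → rep x ≡ rep y))

  OutNbr : Fin n → Fin n → Set
  OutNbr v z = Σ (Fin n) λ j → v ▷ᴿ j ≡ z × z ≢ v

  OutDeg : Fin n → ℕ → Set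
  OutDeg v d = Σ (List (Fin n)) λ zs →
    length zs ≡ d × Unique′ zs × (∀ z → (z ∈ zs → OutNbr v z) × (OutNbr v z → z ∈ zs))
    where
    Unique′ : List (Fin n) → Set
    Unique′ []       = Data.Unit.⊤ where import Data.Unit
    Unique′ (x ∷ xs) = x ∉ xs × Unique′ xs

-- d ≤ (log₂ n)^3, for natural d (real inequality, stated via rationals):
-- every rational p/q ≥ 0 with (p/q)^3 < d satisfies p/q ≤ log₂ n, i.e. 2^p ≤ n^q.
LeCubeLog : ℕ → ℕ → Set
LeCubeLog n d = ∀ p q → 0 < q → p ^ 3 < d * q ^ 3 → 2 ^ p ≤ n ^ q

-- k ≤ (log₂ n)^2, same method.
LeSqLog : ℕ → ℕ → Set
LeSqLog n k = ∀ p q → 0 < q → p ^ 2 < k * q ^ 2 → 2 ^ p ≤ n ^ q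

IsL : ℕ → ℕ → Set
IsL n L = LeSqLog n L × ¬ LeSqLog n (suc L)

module _ {n : ℕ} (R : Rack n) where

  Small : Fin n → Set
  Small v = Σ ℕ λ d → OutDeg R v d × LeCubeLog n d

  -- Greedy us : us (most recently chosen element first) is an initial segment
  -- u₁,…,u_k (listed as u_k ∷ … ∷ u₁) of a greedy ordering of S_{≤Δ}(R):
  -- each new element is a fresh small vertex minimising cp(G_{{u₁,…,u_k,v}})
  -- over the remaining small vertices v (ties broken arbitrarily).
  data Greedy : List (Fin n) → Set where
    g[] : Greedy []
    g∷  : ∀ {us u} → Greedy us → Small u → u ∉ us →
          (Σ ℕ λ a → NumComp R (_∈ (u ∷ us)) a ×
             (∀ v → Small v → v ∉ us → ∀ b → NumComp R (_∈ (v ∷ us)) b → a ≤ b)) →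
          Greedy (u ∷ us)

  -- us enumerates a possible value of T(R): a greedy initial segment of length L
  -- if |S_{≤Δ}(R)| ≥ L, otherwise all of S_{≤Δ}(R) (T(R) = ∅ if it is empty).
  IsTR : List (Fin n) → Set
  IsTR us = Greedy us × Σ ℕ λ L → IsL n L ×
    (length us ≡ L ⊎ (length us < L × (∀ v → Small v → v ∈ us)))

  InTplus : List (Fin n) → Fin n → Set
  InTplus us i = i ∈ us ⊎ Σ (Fin n) λ t → t ∈ us × OutNbr R t i

module Submission where

open import Defs
open import Data.Nat using (ℕ)
open import Data.Fin using (Fin; _≟_)
open import Data.Fin.Permutation using (_⟨$⟩ʳ_; _⟨$⟩ˡ_; inverseˡ)
open import Data.List using (List)
open import Data.List.Membership.Propositional using (_∈_)
open import Data.Product using (_,_)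
open import Data.Sum using (inj₁; inj₂)
open import Relation.Nullary using (yes; no)
open import Relation.Binary.PropositionalEquality
  using (_≡_; refl; sym; cong; subst; module ≡-Reasoning)
open import Relation.Binary.Construct.Closure.ReflexiveTransitive using (ε; _◅_)

-- Self-distributivity (a ▷ y) ▷ j = (a ▷ j) ▷ (y ▷ j) expresses (a)f_y f_j
-- through f_j and f_{(y)f_j}.  Hence if f_y and f_{(y)f_j} are known, then
-- (a)f_j and ((a)f_y)f_j determine each other, so the value of f_j at one vertex
-- of a component of G_S propagates along every edge of colour y ∈ S.  For
-- S = T(R) all the maps needed are among the given data, since
-- (y)f_j ∈ T(R) ∪ Γ_R^+(T(R)) = T^+(R).

open ≡-Reasoning

module _ {n : ℕ} (R : Rack n) where

  ▷-selfDistribʳ : ∀ a y j → _▷_ R (_▷_ R a y) j ≡ _▷_ R (_▷_ R a j) (_▷_ R y j)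
  ▷-selfDistribʳ a y j = sym (begin
    f R (f R j ⟨$⟩ʳ y) ⟨$⟩ʳ (f R j ⟨$⟩ʳ a)              ≡⟨ rack R y j (f R j ⟨$⟩ʳ a) ⟩
    f R j ⟨$⟩ʳ (f R y ⟨$⟩ʳ (f R j ⟨$⟩ˡ (f R j ⟨$⟩ʳ a)))  ≡⟨ cong (λ b → f R j ⟨$⟩ʳ (f R y ⟨$⟩ʳ b)) (inverseˡ (f R j)) ⟩
    f R j ⟨$⟩ʳ (f R y ⟨$⟩ʳ a)                           ∎)

  ▷-cancelʳ : ∀ w {p q} → _▷_ R p w ≡ _▷_ R q w → p ≡ q
  ▷-cancelʳ w {p} {q} eq = begin
    p                          ≡⟨ sym (inverseˡ (f R w)) ⟩
    f R w ⟨$⟩ˡ (_▷_ R p w)     ≡⟨ cong (f R w ⟨$⟩ˡ_) eq ⟩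
    f R w ⟨$⟩ˡ (_▷_ R q w)     ≡⟨ inverseˡ (f R w) ⟩
    q                          ∎

  InTplus-▷ : ∀ {us y} j → y ∈ us → InTplus R us (_▷_ R y j)
  InTplus-▷ {us} {y} j y∈us with _▷_ R y j ≟ y
  ... | yes fixed = inj₁ (subst (_∈ us) (sym fixed) y∈us)
  ... | no moved  = inj₂ (y , y∈us , j , refl , moved)

module Agreement {n : ℕ} (R R' : Rack n) where

  private
    _▸_ _▸′_ : Fin n → Fin n → Fin n
    _▸_  = _▷_ R
    _▸′_ = _▷_ R'

  SameMap : Fin n → Set
  SameMap i = ∀ x → x ▸ i ≡ x ▸′ i

  module _ {y j : Fin n} (same-y : SameMap y) (same-yj : SameMap (y ▸ j))
           (agree-y : y ▸ j ≡ y ▸′ j) where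

    ▸′-via-▸ : ∀ a → (a ▸ y) ▸′ j ≡ (a ▸′ j) ▸ (y ▸ j)
    ▸′-via-▸ a = begin
      (a ▸ y) ▸′ j           ≡⟨ cong (_▸′ j) (same-y a) ⟩
      (a ▸′ y) ▸′ j          ≡⟨ ▷-selfDistribʳ R' a y j ⟩
      (a ▸′ j) ▸′ (y ▸′ j)   ≡⟨ cong ((a ▸′ j) ▸′_) (sym agree-y) ⟩
      (a ▸′ j) ▸′ (y ▸ j)    ≡⟨ sym (same-yj (a ▸′ j)) ⟩
      (a ▸′ j) ▸ (y ▸ j)     ∎

    agree-▸-forward : ∀ {a} → a ▸ j ≡ a ▸′ j → (a ▸ y) ▸ j ≡ (a ▸ y) ▸′ j
    agree-▸-forward {a} agree-a = begin
      (a ▸ y) ▸ j            ≡⟨ ▷-selfDistribʳ R a y j ⟩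
      (a ▸ j) ▸ (y ▸ j)      ≡⟨ cong (_▸ (y ▸ j)) agree-a ⟩
      (a ▸′ j) ▸ (y ▸ j)     ≡⟨ sym (▸′-via-▸ a) ⟩
      (a ▸ y) ▸′ j           ∎

    agree-▸-backward : ∀ {a} → (a ▸ y) ▸ j ≡ (a ▸ y) ▸′ j → a ▸ j ≡ a ▸′ j
    agree-▸-backward {a} agree-ay = ▷-cancelʳ R (y ▸ j) (begin
      (a ▸ j) ▸ (y ▸ j)      ≡⟨ sym (▷-selfDistribʳ R a y j) ⟩
      (a ▸ y) ▸ j            ≡⟨ agree-ay ⟩
      (a ▸ y) ▸′ j           ≡⟨ ▸′-via-▸ a ⟩
      (a ▸′ j) ▸ (y ▸ j)     ∎)

  module _ {S : Fin n → Set} {j : Fin n}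
           (same-S : ∀ y → S y → SameMap y)
           (same-S▸j : ∀ y → S y → SameMap (y ▸ j))
           (agree-S : ∀ y → S y → y ▸ j ≡ y ▸′ j) where

    agree-across-edge : ∀ {a c} → Adj R S a c → a ▸ j ≡ a ▸′ j → c ▸ j ≡ c ▸′ j
    agree-across-edge (y , y∈S , _ , inj₁ refl) =
      agree-▸-forward (same-S y y∈S) (same-S▸j y y∈S) (agree-S y y∈S)
    agree-across-edge (y , y∈S , _ , inj₂ refl) =
      agree-▸-backward (same-S y y∈S) (same-S▸j y y∈S) (agree-S y y∈S)

    agree-on-component : ∀ {v x} → Conn R S v x → v ▸ j ≡ v ▸′ j → x ▸ j ≡ x ▸′ j
    agree-on-component ε            agree-v = agree-v
    agree-on-component (edge ◅ path) agree-v =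
      agree-on-component path (agree-across-edge edge agree-v)

open Agreement using (agree-on-component)

lemma5p6 : (n : ℕ) (R R' : Rack n) (us : List (Fin n)) → IsTR R us →
    (∀ l t → t ∈ us → _▷_ R t l ≡ _▷_ R' t l) →
    (∀ i → InTplus R us i → ∀ x → _▷_ R x i ≡ _▷_ R' x i) →
    (v j : Fin n) → _▷_ R v j ≡ _▷_ R' v j →
    ∀ x → Conn R (_∈ us) v x → _▷_ R x j ≡ _▷_ R' x j
lemma5p6 n R R' us _ same-on-T same-on-T⁺ v j agree-v x v~x =
  agree-on-component R R'
    (λ y y∈T → same-on-T⁺ y (inj₁ y∈T))
    (λ y y∈T → same-on-T⁺ (_▷_ R y j) (InTplus-▷ R j y∈T))
    (λ y y∈T → same-on-T j y y∈T)
    v~x agree-v
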